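{- Let $\mathcal{P}$ be a finite poset with $n$ elements, $\omega:\mathcal{P}\to[n]$ a bijection, $x\lessdot y$ a cover relation of $\mathcal{P}$, and $\mathrm{stat}\in\{\mathrm{maj},\mathrm{inv}\}$. Then \[ e^{\mathrm{stat}}_q(\mathcal{P}, \omega) = e^{\mathrm{stat}}_q(\mathcal{P} \ominus \{(x, y)\} , \omega) - e^{\mathrm{stat}}_q(\mathcal{P}_{\{(x,y)\}}, \omega). \]
   Context: The linear extensions of a labeled poset $(\mathcal{P},\omega)$ are the permutations $\omega\circ f^{ -1}$ (as words) for $f:\mathcal{P}\to[n]$ order-preserving bijections. For a permutation $\sigma$, $\mathrm{maj}(\sigma)=\sum_{i:\sigma(i)>\sigma(i+1)}i$ and $\mathrm{inv}(\sigma)$ is its number of inversions; $e^{\mathrm{stat}}_q(\mathcal{P},\omega)=\sum_\sigma q^{\mathrm{stat}(\sigma)}$ over linear extensions of $(\mathcal{P},\omega)$. $\mathcal{P}\ominus\{(x,y)\}$ is the poset on the same set whose order is generated by all cover relations other than $x\lessdot y$; $\mathcal{P}_{\{(x,y)\}}$ is obtained from it by adding $y<x$ and taking the transitive closure; both carry the same labeling $\omega$. -}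

module Defs where

open import Level using (0ℓ)
open import Data.Bool using (Bool; true; false; _∧_; _∨_; not; if_then_else_)
open import Data.Nat using (ℕ; zero; suc; _+_) renaming (_≡ᵇ_ to _==ℕ_)
open import Data.Fin using (Fin; zero; suc; toℕ; _<?_; _≤?_)
open import Data.Fin.Properties using (_≟_)
open import Data.Fin.Base using (_<_; _≤_)
open import Data.List using (List; []; _∷_; map; concatMap; filter; length; allFin)
open import Data.Vec.Functional using (Vector) renaming (_∷_ to _∷ᶠ_)
open import Data.Product using (_×_)
open import Relation.Nullary using (¬_; Dec; yes; no)
open import Relation.Nullary.Decidable using (⌊_⌋)
open import Relation.Binary.PropositionalEquality using (_≡_; _≢_)
open import Relation.Binary using (Rel)

anyFin : ∀ {n} → (Fin n → Bool) → Bool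
anyFin {n} p = Data.List.foldr (λ a r → p a ∨ r) false (allFin n)

allFinB : ∀ {n} → (Fin n → Bool) → Bool
allFinB {n} p = Data.List.foldr (λ a r → p a ∧ r) true (allFin n)

_==_ : ∀ {n} → Fin n → Fin n → Bool
a == b = ⌊ a ≟ b ⌋

BRel : ℕ → Set
BRel n = Fin n → Fin n → Bool

ltB : ∀ {n} → BRel n → BRel n
ltB le a b = le a b ∧ not (a == b)

coverB : ∀ {n} → BRel n → BRel n
coverB le a b = ltB le a b ∧ not (anyFin (λ z → ltB le a z ∧ ltB le z b))

-- reflexive-transitive closure: paths of length ≤ k (k = n suffices on n elements)
closeStep : ∀ {n} → BRel n → BRel n → BRel n
closeStep R S a b = S a b ∨ anyFin (λ c → S a c ∧ R c b)

closeIter : ∀ {n} → ℕ → BRel n → BRel n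
closeIter zero    R a b = a == b
closeIter (suc k) R = closeStep R (closeIter k R)

rtClosure : ∀ {n} → BRel n → BRel n
rtClosure {n} R = closeIter n R

-- P ⊖ {(x,y)}: order generated by all cover relations of P other than x ⋖ y
deleteCover : ∀ {n} → BRel n → Fin n → Fin n → BRel n
deleteCover le x y = rtClosure (λ a b → coverB le a b ∧ not ((a == x) ∧ (b == y)))

-- P_{(x,y)}: P ⊖ {(x,y)} with y < x added, transitively closed
flipCover : ∀ {n} → BRel n → Fin n → Fin n → BRel n
flipCover le x y = rtClosure (λ a b → (coverB le a b ∧ not ((a == x) ∧ (b == y)))
                                       ∨ ((a == y) ∧ (b == x)))

allWords : ∀ {n} (m : ℕ) → List (Vector (Fin n) m)
allWords zero = (λ ()) ∷ []
allWords {n} (suc m) = concatMap (λ a → map (λ w → a ∷ᶠ w) (allWords m)) (allFin n)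

-- τ : positions → elements, listing the elements in the order f⁻¹(0), f⁻¹(1), ...
-- τ is a bijection and f = τ⁻¹ is order-preserving:  τ i ≤_P τ j  ⇒  i ≤ j
isLinExtWord : ∀ {n} → BRel n → Vector (Fin n) n → Bool
isLinExtWord le τ =
  allFinB (λ i → allFinB (λ j →
    (if i == j then true else not (τ i == τ j)) ∧
    (if le (τ i) (τ j) then ⌊ i ≤? j ⌋ else true)))

-- linear extensions of (P, ω) as permutations σ = ω ∘ f⁻¹ (words)
linExts : ∀ {n} → BRel n → (Fin n → Fin n) → List (Vector (Fin n) n)
linExts le ω = map (λ τ i → ω (τ i)) (filter (λ τ → isLinExtWord le τ ≟ᵇ true) (allWords _))
  where
  _≟ᵇ_ : (a b : Bool) → Dec (a ≡ b)
  _≟ᵇ_ = Data.Bool._≟_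

-- statistics (positions 1-based: descent between positions i+1, i+2 contributes i+1)
maj : ∀ {n} → Vector (Fin n) n → ℕ
maj {zero} σ = 0
maj {suc n} σ = Data.List.foldr _+_ 0
  (map (λ i → if ⌊ σ (Data.Fin.suc i) <? σ (Data.Fin.inject₁ i) ⌋ then suc (toℕ i) else 0)
       (allFin n))

inv : ∀ {n} → Vector (Fin n) n → ℕ
inv {n} σ = Data.List.foldr _+_ 0
  (concatMap (λ i → map (λ j → if ⌊ i <? j ⌋ ∧ ⌊ σ j <? σ i ⌋ then 1 else 0) (allFin n))
             (allFin n))

data Stat : Set where
  majS invS : Stat

evalStat : Stat → ∀ {n} → Vector (Fin n) n → ℕ
evalStat majS = maj
evalStat invS = inv

-- coefficient of q^k in e^stat_q(P, ω)
eCoeff : Stat → ∀ {n} → BRel n → (Fin n → Fin n) → ℕ → ℕ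
eCoeff st le ω k = length (filter (λ σ → evalStat st σ Data.Nat.≟ k) (linExts le ω))

toB : ∀ {n} {_≼_ : Rel (Fin n) 0ℓ} → (∀ a b → Dec (a ≼ b)) → BRel n
toB d a b = ⌊ d a b ⌋

_⋖[_]_ : ∀ {n} → Fin n → Rel (Fin n) 0ℓ → Fin n → Set
x ⋖[ _≼_ ] y = (x ≼ y × x ≢ y) × (∀ z → ¬ ((x ≼ z × x ≢ z) × (z ≼ y × z ≢ y)))

-- A linear extension of P ⊖ {(x, y)} puts x either before or after y.  Those putting x first
-- respect every cover relation of P, hence (the order of a finite poset being generated by its
-- covers) are exactly the linear extensions of P; those putting y first are exactly the linear
-- extensions of P_{(x,y)}.  So the linear extensions of P ⊖ {(x, y)} are the disjoint union of
-- the other two families already as words of positions, and the identity holds coefficientwise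
-- for any statistic and any labelling ω.
module Submission where

open import Defs
open import Level using (0ℓ)
open import Data.Bool using (Bool; true; false; _∧_; _∨_; not; if_then_else_)
import Data.Bool
open import Data.Bool.Properties using (∧-conicalˡ; ∧-conicalʳ; not-injective)
open import Data.Nat as ℕ using (ℕ; zero; suc; _+_)
import Data.Nat.Properties as ℕ
open import Data.Fin using (Fin; _≤?_; punchOut)
open import Data.Fin.Properties
  using (_≟_; any?; pigeonhole; punchOut-injective; ≤-reflexive; ≤-trans; ≤-antisym; ≤-total; <⇒≢)
open import Data.Fin.Base using (_≤_; _<_)
open import Data.Fin.Subset using (Subset; ∣_∣) renaming (_∈_ to _∈ₛ_)
open import Data.Fin.Subset.Properties using (p⊂q⇒∣p∣<∣q∣)
open import Data.List using ([]; _∷_; map; filter; length; allFin; foldr)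
open import Data.List.Membership.Propositional using (_∈_)
open import Data.List.Membership.Propositional.Properties using (∈-allFin)
open import Data.List.Relation.Unary.Any using (here; there)
open import Data.Vec using (tabulate)
open import Data.Vec.Properties using (lookup⇒[]=; []=⇒lookup; lookup∘tabulate)
open import Data.Vec.Functional using (Vector)
open import Data.Product using (_×_; _,_; ∃; ∃₂; proj₁; proj₂)
open import Data.Sum using (_⊎_; inj₁; inj₂)
open import Data.Integer using (+_; _-_; _⊖_)
import Data.Integer.Properties as ℤ
open import Function.Definitions using (Injective; Bijective)
open import Relation.Nullary using (¬_; Dec; yes; no; does; contradiction)
open import Relation.Nullary.Decidable using (⌊_⌋; isYes≗does; dec-true; dec-false)
open import Relation.Unary using (Pred; Decidable)
open import Relation.Binary using (Rel; IsDecPartialOrder)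
open import Relation.Binary.PropositionalEquality
  using (_≡_; _≢_; refl; sym; trans; cong; subst₂; module ≡-Reasoning)

true≢false : ∀ {b} → b ≡ true → b ≢ false
true≢false refl ()

∧-intro : ∀ {a b} → a ≡ true → b ≡ true → a ∧ b ≡ true
∧-intro refl refl = refl

∨-elim : ∀ {a b} → a ∨ b ≡ true → a ≡ true ⊎ b ≡ true
∨-elim {true}  _ = inj₁ refl
∨-elim {false} e = inj₂ e

∨-introˡ : ∀ {a b} → a ≡ true → a ∨ b ≡ true
∨-introˡ refl = refl

∨-introʳ : ∀ {a b} → b ≡ true → a ∨ b ≡ true
∨-introʳ {true}  _ = refl
∨-introʳ {false} e = e

≡-∨ : ∀ {d p f} → (p ≡ true → d ≡ true) → (f ≡ true → d ≡ true) →
      (d ≡ true → p ≡ true ⊎ f ≡ true) → d ≡ p ∨ f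
≡-∨ {p = true}  p⇒d _ _ = p⇒d refl
≡-∨ {p = false} {true} _ f⇒d _ = f⇒d refl
≡-∨ {false} {false} {false} _ _ _ = refl
≡-∨ {true}  {false} {false} _ _ d⇒p⊎f with d⇒p⊎f refl
... | inj₁ ()
... | inj₂ ()

⌊⌋-true⇒ : ∀ {A : Set} (a? : Dec A) → ⌊ a? ⌋ ≡ true → A
⌊⌋-true⇒ (yes a) _ = a

⇒⌊⌋-true : ∀ {A : Set} (a? : Dec A) → A → ⌊ a? ⌋ ≡ true
⇒⌊⌋-true a? a = trans (isYes≗does a?) (dec-true a? a)

⇒⌊⌋-false : ∀ {A : Set} (a? : Dec A) → ¬ A → ⌊ a? ⌋ ≡ false
⇒⌊⌋-false a? ¬a = trans (isYes≗does a?) (dec-false a? ¬a)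

==⇒≡ : ∀ {n} {a b : Fin n} → (a == b) ≡ true → a ≡ b
==⇒≡ = ⌊⌋-true⇒ (_ ≟ _)

≡⇒== : ∀ {n} {a b : Fin n} → a ≡ b → (a == b) ≡ true
≡⇒== = ⇒⌊⌋-true (_ ≟ _)

≢⇒==false : ∀ {n} {a b : Fin n} → a ≢ b → (a == b) ≡ false
≢⇒==false = ⇒⌊⌋-false (_ ≟ _)

module _ {A : Set} (p : A → Bool) where

  foldr-∧-elim : ∀ xs → foldr (λ a r → p a ∧ r) true xs ≡ true → ∀ {a} → a ∈ xs → p a ≡ true
  foldr-∧-elim (x ∷ xs) h (here refl) = ∧-conicalˡ _ _ h
  foldr-∧-elim (x ∷ xs) h (there a∈xs) = foldr-∧-elim xs (∧-conicalʳ (p x) _ h) a∈xs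

  foldr-∧-intro : ∀ xs → (∀ a → p a ≡ true) → foldr (λ a r → p a ∧ r) true xs ≡ true
  foldr-∧-intro []       _ = refl
  foldr-∧-intro (x ∷ xs) h = ∧-intro (h x) (foldr-∧-intro xs h)

  foldr-∨-elim : ∀ xs → foldr (λ a r → p a ∨ r) false xs ≡ true → ∃ λ a → p a ≡ true
  foldr-∨-elim (x ∷ xs) h with ∨-elim {p x} h
  ... | inj₁ px = x , px
  ... | inj₂ h′ = foldr-∨-elim xs h′

  foldr-∨-intro : ∀ xs {a} → a ∈ xs → p a ≡ true → foldr (λ a r → p a ∨ r) false xs ≡ true
  foldr-∨-intro (x ∷ xs) (here refl) pa = ∨-introˡ pa
  foldr-∨-intro (x ∷ xs) (there a∈xs) pa = ∨-introʳ {p x} (foldr-∨-intro xs a∈xs pa)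

allFinB-elim : ∀ {n} (p : Fin n → Bool) → allFinB p ≡ true → ∀ a → p a ≡ true
allFinB-elim {n} p h a = foldr-∧-elim p (allFin n) h (∈-allFin a)

allFinB-intro : ∀ {n} (p : Fin n → Bool) → (∀ a → p a ≡ true) → allFinB p ≡ true
allFinB-intro {n} p = foldr-∧-intro p (allFin n)

anyFin-elim : ∀ {n} (p : Fin n → Bool) → anyFin p ≡ true → ∃ λ a → p a ≡ true
anyFin-elim {n} p = foldr-∨-elim p (allFin n)

anyFin-intro : ∀ {n} (p : Fin n → Bool) a → p a ≡ true → anyFin p ≡ true
anyFin-intro {n} p a = foldr-∨-intro p (allFin n) (∈-allFin a)

injective⇒surjective : ∀ {n} (τ : Fin n → Fin n) → Injective _≡_ _≡_ τ → ∀ b → ∃ λ i → τ i ≡ b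
-- If b were missed, punchOut b would squeeze τ injectively into Fin m, against pigeonhole.
injective⇒surjective {suc m} τ inj b with any? (λ i → τ i ≟ b)
... | yes hit = hit
... | no miss = no-collision (pigeonhole (ℕ.n<1+n m) (λ i → punchOut (b≢τ i)))
  where
  b≢τ : ∀ i → b ≢ τ i
  b≢τ i b≡τi = miss (i , sym b≡τi)
  no-collision : (∃₂ λ i j → i < j × punchOut (b≢τ i) ≡ punchOut (b≢τ j)) → ∃ λ i → τ i ≡ b
  no-collision (i , j , i<j , eq) = contradiction (inj (punchOut-injective (b≢τ i) (b≢τ j) eq)) (<⇒≢ i<j)

module _ {n : ℕ} where

  infix 4 _⊆ᵇ_
  infixl 6 _∪ᵇ_ _∖ᵇ_

  _⊆ᵇ_ : BRel n → BRel n → Set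
  R ⊆ᵇ S = ∀ a b → R a b ≡ true → S a b ≡ true

  _∪ᵇ_ : BRel n → BRel n → BRel n
  (R ∪ᵇ S) a b = R a b ∨ S a b

  _∖ᵇ_ : BRel n → BRel n → BRel n
  (R ∖ᵇ S) a b = R a b ∧ not (S a b)

  edge : Fin n → Fin n → BRel n
  edge u v a b = (a == u) ∧ (b == v)

  ⊆ᵇ-trans : ∀ {R S T} → R ⊆ᵇ S → S ⊆ᵇ T → R ⊆ᵇ T
  ⊆ᵇ-trans R⊆S S⊆T a b r = S⊆T a b (R⊆S a b r)

  ⊆ᵇ-∪ᵇˡ : ∀ R S → R ⊆ᵇ R ∪ᵇ S
  ⊆ᵇ-∪ᵇˡ R S a b = ∨-introˡ

  ⊆ᵇ-∪ᵇʳ : ∀ R S → S ⊆ᵇ R ∪ᵇ S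
  ⊆ᵇ-∪ᵇʳ R S a b = ∨-introʳ {R a b}

  ∖ᵇ-⊆ᵇ : ∀ R S → R ∖ᵇ S ⊆ᵇ R
  ∖ᵇ-⊆ᵇ R S a b = ∧-conicalˡ _ _

  ⊆ᵇ-∖ᵇ-∪ᵇ : ∀ R S → R ⊆ᵇ R ∖ᵇ S ∪ᵇ S
  ⊆ᵇ-∖ᵇ-∪ᵇ R S a b r with S a b
  ... | true  = ∨-introʳ {R a b ∧ false} refl
  ... | false = ∨-introˡ (∧-intro r refl)

  edge⇒≡ : ∀ {u v a b} → edge u v a b ≡ true → a ≡ u × b ≡ v
  edge⇒≡ {u} {a = a} e = ==⇒≡ (∧-conicalˡ _ _ e) , ==⇒≡ (∧-conicalʳ (a == u) _ e)

  closeIter-refl : ∀ k (R : BRel n) a → closeIter k R a a ≡ true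
  closeIter-refl zero    R a = ≡⇒== refl
  closeIter-refl (suc k) R a = ∨-introˡ (closeIter-refl k R a)

⊆ᵇ-rtClosure : ∀ {n} (R : BRel n) → R ⊆ᵇ rtClosure R
⊆ᵇ-rtClosure {suc m} R a b r =
  ∨-introʳ {closeIter m R a b} (anyFin-intro _ a (∧-intro (closeIter-refl m R a) r))

Extends : ∀ {n} → BRel n → Vector (Fin n) n → Set
Extends R τ = ∀ i j → R (τ i) (τ j) ≡ true → i ≤ j

LinearExtension : ∀ {n} → BRel n → Vector (Fin n) n → Set
LinearExtension R τ = Injective _≡_ _≡_ τ × Extends R τ

isLinExtWord⇒ : ∀ {n} (R : BRel n) τ → isLinExtWord R τ ≡ true → LinearExtension R τ
isLinExtWord⇒ R τ h = injective , extends
  where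
  distinct : ∀ i j → (if i == j then true else not (τ i == τ j)) ≡ true
  distinct i j = ∧-conicalˡ _ _ (allFinB-elim _ (allFinB-elim _ h i) j)
  ordered : ∀ i j → (if R (τ i) (τ j) then ⌊ i ≤? j ⌋ else true) ≡ true
  ordered i j = ∧-conicalʳ (if i == j then true else not (τ i == τ j)) _ (allFinB-elim _ (allFinB-elim _ h i) j)
  injective : Injective _≡_ _≡_ τ
  injective {i} {j} τi≡τj with i ≟ j | distinct i j
  ... | yes i≡j | _     = i≡j
  ... | no  _   | τi≢τj = contradiction (not-injective τi≢τj) (true≢false (≡⇒== τi≡τj))
  extends : Extends R τ
  extends i j r with R (τ i) (τ j) | ordered i j
  extends i j refl | true | i≤j = ⌊⌋-true⇒ (i ≤? j) i≤j

⇒isLinExtWord : ∀ {n} (R : BRel n) τ → LinearExtension R τ → isLinExtWord R τ ≡ true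
⇒isLinExtWord R τ (injective , extends) =
  allFinB-intro _ λ i → allFinB-intro _ λ j → ∧-intro (distinct i j) (ordered i j)
  where
  distinct : ∀ i j → (if i == j then true else not (τ i == τ j)) ≡ true
  distinct i j with i ≟ j
  ... | yes _  = refl
  ... | no i≢j = cong not (≢⇒==false (λ τi≡τj → i≢j (injective τi≡τj)))
  ordered : ∀ i j → (if R (τ i) (τ j) then ⌊ i ≤? j ⌋ else true) ≡ true
  ordered i j with R (τ i) (τ j) in r
  ... | false = refl
  ... | true  = ⇒⌊⌋-true (i ≤? j) (extends i j r)

Extends-antitone : ∀ {n} {R S : BRel n} {τ} → R ⊆ᵇ S → Extends S τ → Extends R τ
Extends-antitone R⊆S ext i j r = ext i j (R⊆S _ _ r)

Extends-∪ᵇ : ∀ {n} (R S : BRel n) {τ} → Extends R τ → Extends S τ → Extends (R ∪ᵇ S) τ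
Extends-∪ᵇ R S {τ} extR extS i j r with ∨-elim {R (τ i) (τ j)} r
... | inj₁ rR = extR i j rR
... | inj₂ rS = extS i j rS

module _ {n} {τ : Vector (Fin n) n} (injective : Injective _≡_ _≡_ τ) where

  position : Fin n → Fin n
  position b = proj₁ (injective⇒surjective τ injective b)

  τ∘position : ∀ b → τ (position b) ≡ b
  τ∘position b = proj₂ (injective⇒surjective τ injective b)

  Extends-closeIter : ∀ R k → Extends R τ → Extends (closeIter k R) τ
  Extends-closeIter R zero    ext i j e = ≤-reflexive (injective (==⇒≡ e))
  Extends-closeIter R (suc k) ext i j e with ∨-elim {closeIter k R (τ i) (τ j)} e
  ... | inj₁ short = Extends-closeIter R k ext i j short
  ... | inj₂ long with anyFin-elim _ long
  ...   | c , path with position c | τ∘position c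
  ...     | l | refl =
    ≤-trans (Extends-closeIter R k ext i l (∧-conicalˡ _ _ path))
            (ext l j (∧-conicalʳ (closeIter k R (τ i) (τ l)) _ path))

  Extends-rtClosure : ∀ R → Extends R τ → Extends (rtClosure R) τ
  Extends-rtClosure R = Extends-closeIter R n

  Extends-edge : ∀ {u v} → position u ≤ position v → Extends (edge u v) τ
  Extends-edge {u} {v} pu≤pv i j e with edge⇒≡ {u = u} {v = v} e
  ... | τi≡u , τj≡v = subst₂ _≤_ (injective (trans (τ∘position u) (sym τi≡u)))
                                 (injective (trans (τ∘position v) (sym τj≡v))) pu≤pv

  Extends-edge⇒ : ∀ {u v} → Extends (edge u v) τ → position u ≤ position v
  Extends-edge⇒ {u} {v} ext =
    ext (position u) (position v) (∧-intro (≡⇒== (τ∘position u)) (≡⇒== (τ∘position v)))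

  Extends-edge-dichotomy : ∀ u v → Extends (edge u v) τ ⊎ Extends (edge v u) τ
  Extends-edge-dichotomy u v with ≤-total (position u) (position v)
  ... | inj₁ pu≤pv = inj₁ (Extends-edge pu≤pv)
  ... | inj₂ pv≤pu = inj₂ (Extends-edge pv≤pu)

  Extends-edge-asym : ∀ {u v} → u ≢ v → Extends (edge u v) τ → ¬ Extends (edge v u) τ
  Extends-edge-asym {u} {v} u≢v uv vu =
    u≢v (begin
      u                ≡⟨ sym (τ∘position u) ⟩
      τ (position u)   ≡⟨ cong τ (≤-antisym (Extends-edge⇒ uv) (Extends-edge⇒ vu)) ⟩
      τ (position v)   ≡⟨ τ∘position v ⟩
      v                ∎)
    where open ≡-Reasoning

module FinitePoset {n} {_≼_ : Rel (Fin n) 0ℓ} (isPO : IsDecPartialOrder _≡_ _≼_) where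
  open IsDecPartialOrder isPO using (reflexive; antisym) renaming (_≤?_ to _≼?_; trans to ≼-trans)

  le : BRel n
  le = toB _≼?_

  le⇒≼ : ∀ {a b} → le a b ≡ true → a ≼ b
  le⇒≼ = ⌊⌋-true⇒ (_ ≼? _)

  ≼⇒le : ∀ {a b} → a ≼ b → le a b ≡ true
  ≼⇒le = ⇒⌊⌋-true (_ ≼? _)

  ltB⇒ : ∀ {a b} → ltB le a b ≡ true → a ≼ b × a ≢ b
  ltB⇒ {a} {b} e = le⇒≼ (∧-conicalˡ _ _ e) , λ a≡b →
    true≢false (≡⇒== a≡b) (not-injective (∧-conicalʳ (le a b) _ e))

  ⇒ltB : ∀ {a b} → a ≼ b → a ≢ b → ltB le a b ≡ true
  ⇒ltB a≼b a≢b = ∧-intro (≼⇒le a≼b) (cong not (≢⇒==false a≢b))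

  coverB⊆ᵇle : coverB le ⊆ᵇ le
  coverB⊆ᵇle _ _ c = ∧-conicalˡ _ _ (∧-conicalˡ _ _ c)

  cover⊎between : ∀ {a b} → a ≼ b → a ≢ b →
                  coverB le a b ≡ true ⊎ ∃ λ z → (a ≼ z × a ≢ z) × (z ≼ b × z ≢ b)
  cover⊎between {a} {b} a≼b a≢b with anyFin (λ z → ltB le a z ∧ ltB le z b) in between
  ... | false = inj₁ (∧-intro (⇒ltB a≼b a≢b) refl)
  ... | true with anyFin-elim _ between
  ...   | z , a<z<b = inj₂ (z , ltB⇒ (∧-conicalˡ _ _ a<z<b) , ltB⇒ (∧-conicalʳ (ltB le a z) _ a<z<b))

  ↓_ : Fin n → Subset n
  ↓ a = tabulate (λ z → le z a)

  height : Fin n → ℕ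
  height a = ∣ ↓ a ∣

  height-< : ∀ {a b} → a ≼ b → a ≢ b → height a ℕ.< height b
  height-< {a} {b} a≼b a≢b = p⊂q⇒∣p∣<∣q∣ (↓a⊆↓b , b , b∈↓b , b∉↓a)
    where
    ∈↓⇒ : ∀ {z c} → z ∈ₛ ↓ c → z ≼ c
    ∈↓⇒ {z} {c} z∈ = le⇒≼ (trans (sym (lookup∘tabulate (λ w → le w c) z)) ([]=⇒lookup z∈))
    ⇒∈↓ : ∀ {z c} → z ≼ c → z ∈ₛ ↓ c
    ⇒∈↓ {z} {c} z≼c = lookup⇒[]= z (↓ c) (trans (lookup∘tabulate (λ w → le w c) z) (≼⇒le z≼c))
    ↓a⊆↓b : ∀ {z} → z ∈ₛ ↓ a → z ∈ₛ ↓ b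
    ↓a⊆↓b z∈ = ⇒∈↓ (≼-trans (∈↓⇒ z∈) a≼b)
    b∈↓b : b ∈ₛ ↓ b
    b∈↓b = ⇒∈↓ (reflexive refl)
    b∉↓a : ¬ (b ∈ₛ ↓ a)
    b∉↓a b∈ = a≢b (antisym a≼b (∈↓⇒ b∈))

  -- Recursion on a bound for the height difference, which drops strictly on both halves of an
  -- interval split at an intermediate element.
  cover-induction : (S : Rel (Fin n) 0ℓ) → (∀ a → S a a) → (∀ {a b c} → S a b → S b c → S a c) →
                    (∀ {a b} → coverB le a b ≡ true → S a b) → ∀ {a b} → a ≼ b → S a b
  cover-induction S S-refl S-trans S-cover {a} {b} a≼b =
    go (height b) a≼b (ℕ.m≤m+n (height b) (height a))
    where
    go : ∀ m {a b} → a ≼ b → height b ℕ.≤ m + height a → S a b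
    go m {a} {b} a≼b bound with a ≟ b
    ... | yes refl = S-refl a
    ... | no a≢b with m | cover⊎between a≼b a≢b
    ...   | zero  | _ = contradiction (ℕ.<-≤-trans (height-< a≼b a≢b) bound) (ℕ.<-irrefl refl)
    ...   | suc m′ | inj₁ a⋖b = S-cover a⋖b
    ...   | suc m′ | inj₂ (z , (a≼z , a≢z) , (z≼b , z≢b)) =
      S-trans (go m′ a≼z (ℕ.≤-pred (ℕ.≤-trans (height-< z≼b z≢b) bound)))
              (go m′ z≼b (ℕ.≤-trans bound (ℕ.≤-trans (ℕ.≤-reflexive (sym (ℕ.+-suc m′ (height a))))
                                                     (ℕ.+-monoʳ-≤ m′ (height-< a≼z a≢z)))))

  Extends-coverB⇒Extends : ∀ {τ} → Injective _≡_ _≡_ τ → Extends (coverB le) τ → Extends le τ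
  Extends-coverB⇒Extends {τ} injective ext i j lij =
    cover-induction Before before-refl before-trans before-cover (le⇒≼ lij) refl refl
    where
    Before : Rel (Fin n) 0ℓ
    Before a b = ∀ {i j} → τ i ≡ a → τ j ≡ b → i ≤ j
    before-refl : ∀ a → Before a a
    before-refl a τi≡a τj≡a = ≤-reflexive (injective (trans τi≡a (sym τj≡a)))
    before-trans : ∀ {a b c} → Before a b → Before b c → Before a c
    before-trans ab bc τi≡a τj≡c =
      ≤-trans (ab τi≡a (τ∘position injective _)) (bc (τ∘position injective _) τj≡c)
    before-cover : ∀ {a b} → coverB le a b ≡ true → Before a b
    before-cover c refl refl = ext _ _ c

length-filter-map-filter-∨ :
  ∀ {A B : Set} {ℓ} {Q : Pred B ℓ} (Q? : Decidable Q) (g : A → B) (d p f : A → Bool) →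
  (∀ a → d a ≡ p a ∨ f a) → (∀ a → p a ≡ true → f a ≡ false) → ∀ xs →
  length (filter Q? (map g (filter (λ a → d a Data.Bool.≟ true) xs)))
  ≡ length (filter Q? (map g (filter (λ a → p a Data.Bool.≟ true) xs)))
    + length (filter Q? (map g (filter (λ a → f a Data.Bool.≟ true) xs)))
length-filter-map-filter-∨ Q? g d p f d≡p∨f disjoint [] = refl
length-filter-map-filter-∨ Q? g d p f d≡p∨f disjoint (a ∷ xs)
  rewrite d≡p∨f a with p a in pa | f a in fa | length-filter-map-filter-∨ Q? g d p f d≡p∨f disjoint xs
... | true  | true  | _  = contradiction (trans (sym fa) (disjoint a pa)) λ ()
... | false | false | ih = ih
... | true  | false | ih with does (Q? (g a))
...   | true  = cong suc ih
...   | false = ih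
length-filter-map-filter-∨ Q? g d p f d≡p∨f disjoint (a ∷ xs) | false | true | ih with does (Q? (g a))
...   | true  = trans (cong suc ih) (sym (ℕ.+-suc _ _))
...   | false = ih

module DeleteCover {n} {_≼_ : Rel (Fin n) 0ℓ} (isPO : IsDecPartialOrder _≡_ _≼_)
                   {x y : Fin n} (x≼y : x ≼ y) (x≢y : x ≢ y) where
  open FinitePoset isPO

  kept : BRel n
  kept = coverB le ∖ᵇ edge x y

  kept⊆ᵇle : kept ⊆ᵇ le
  kept⊆ᵇle = ⊆ᵇ-trans (∖ᵇ-⊆ᵇ (coverB le) (edge x y)) coverB⊆ᵇle

  edge⊆ᵇle : edge x y ⊆ᵇ le
  edge⊆ᵇle a b e with edge⇒≡ {u = x} {v = y} {a} {b} e
  ... | refl , refl = ≼⇒le x≼y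

  reversed : BRel n
  reversed = kept ∪ᵇ edge y x

  le⇒deleted : ∀ {τ} → LinearExtension le τ → LinearExtension (deleteCover le x y) τ
  le⇒deleted (inj , ext) = inj , Extends-rtClosure inj kept (Extends-antitone kept⊆ᵇle ext)

  flipped⇒deleted : ∀ {τ} → LinearExtension (flipCover le x y) τ → LinearExtension (deleteCover le x y) τ
  flipped⇒deleted (inj , ext) =
    inj , Extends-rtClosure inj kept
            (Extends-antitone (⊆ᵇ-trans (⊆ᵇ-∪ᵇˡ kept (edge y x)) (⊆ᵇ-rtClosure reversed)) ext)

  deleted⇒le⊎flipped : ∀ {τ} → LinearExtension (deleteCover le x y) τ →
                       LinearExtension le τ ⊎ LinearExtension (flipCover le x y) τ
  deleted⇒le⊎flipped {τ} (inj , ext) = Data.Sum.map x-first⇒le y-first⇒flipped (Extends-edge-dichotomy inj x y)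
    where
    ext-kept : Extends kept τ
    ext-kept = Extends-antitone (⊆ᵇ-rtClosure kept) ext
    x-first⇒le : Extends (edge x y) τ → LinearExtension le τ
    x-first⇒le x-first = inj , Extends-coverB⇒Extends inj
      (Extends-antitone (⊆ᵇ-∖ᵇ-∪ᵇ (coverB le) (edge x y)) (Extends-∪ᵇ kept (edge x y) ext-kept x-first))
    y-first⇒flipped : Extends (edge y x) τ → LinearExtension (flipCover le x y) τ
    y-first⇒flipped y-first = inj , Extends-rtClosure inj reversed (Extends-∪ᵇ kept (edge y x) ext-kept y-first)

  le⇒¬flipped : ∀ {τ} → LinearExtension le τ → ¬ LinearExtension (flipCover le x y) τ
  le⇒¬flipped (inj , ext) (_ , ext-flipped) =
    Extends-edge-asym inj x≢y (Extends-antitone edge⊆ᵇle ext)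
      (Extends-antitone (⊆ᵇ-trans (⊆ᵇ-∪ᵇʳ kept (edge y x)) (⊆ᵇ-rtClosure reversed)) ext-flipped)

  isLinExtWord-deleteCover : ∀ τ → isLinExtWord (deleteCover le x y) τ
                                   ≡ isLinExtWord le τ ∨ isLinExtWord (flipCover le x y) τ
  isLinExtWord-deleteCover τ = ≡-∨
    (λ e → ⇒isLinExtWord (deleteCover le x y) τ (le⇒deleted (isLinExtWord⇒ le τ e)))
    (λ e → ⇒isLinExtWord (deleteCover le x y) τ (flipped⇒deleted (isLinExtWord⇒ (flipCover le x y) τ e)))
    (λ e → Data.Sum.map (⇒isLinExtWord le τ) (⇒isLinExtWord (flipCover le x y) τ)
                        (deleted⇒le⊎flipped (isLinExtWord⇒ (deleteCover le x y) τ e)))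

  isLinExtWord-le⇒¬flipped : ∀ τ → isLinExtWord le τ ≡ true → isLinExtWord (flipCover le x y) τ ≡ false
  isLinExtWord-le⇒¬flipped τ e with isLinExtWord (flipCover le x y) τ in flipped
  ... | false = refl
  ... | true  = contradiction (isLinExtWord⇒ (flipCover le x y) τ flipped) (le⇒¬flipped (isLinExtWord⇒ le τ e))

  eCoeff-deleteCover : ∀ st (ω : Fin n → Fin n) k →
    eCoeff st (deleteCover le x y) ω k ≡ eCoeff st le ω k + eCoeff st (flipCover le x y) ω k
  eCoeff-deleteCover st ω k =
    length-filter-map-filter-∨ (λ σ → evalStat st σ ℕ.≟ k) (λ τ i → ω (τ i))
      (isLinExtWord (deleteCover le x y)) (isLinExtWord le) (isLinExtWord (flipCover le x y))
      isLinExtWord-deleteCover isLinExtWord-le⇒¬flipped (allWords n)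

m≡m+n-n : ∀ m n → + m ≡ + (m + n) - + n
m≡m+n-n m n = sym (begin
  + (m + n) - + n   ≡⟨ ℤ.m-n≡m⊖n (m + n) n ⟩
  (m + n) ⊖ n       ≡⟨ ℤ.⊖-≥ (ℕ.m≤n+m n m) ⟩
  + (m + n ℕ.∸ n)   ≡⟨ cong +_ (ℕ.m+n∸n≡m m n) ⟩
  + m               ∎)
  where open ≡-Reasoning

lemma5p1 : (n : ℕ) (_≼_ : Rel (Fin n) 0ℓ) (isPO : IsDecPartialOrder _≡_ _≼_)
    (ω : Fin n → Fin n) → Bijective _≡_ _≡_ ω →
    (x y : Fin n) → x ⋖[ _≼_ ] y → (st : Stat) → (k : ℕ) →
    + eCoeff st (toB (IsDecPartialOrder._≤?_ isPO)) ω k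
    ≡ + eCoeff st (deleteCover (toB (IsDecPartialOrder._≤?_ isPO)) x y) ω k
    - + eCoeff st (flipCover (toB (IsDecPartialOrder._≤?_ isPO)) x y) ω k
lemma5p1 n _≼_ isPO ω _ x y x⋖y st k = begin
  + #le                            ≡⟨ m≡m+n-n #le #flipped ⟩
  + (#le + #flipped) - + #flipped  ≡⟨ cong (λ c → + c - + #flipped) (sym (eCoeff-deleteCover st ω k)) ⟩
  + #deleted - + #flipped          ∎
  where
  open ≡-Reasoning
  open FinitePoset isPO using (le)
  open DeleteCover isPO (proj₁ (proj₁ x⋖y)) (proj₂ (proj₁ x⋖y))
  #le #deleted #flipped : ℕ
  #le      = eCoeff st le ω k
  #deleted = eCoeff st (deleteCover le x y) ω k
  #flipped = eCoeff st (flipCover le x y) ω k
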